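{- The rational function $\mathbf{\Gamma}_T^{(1)}$ determines all double-degree numbers of $T$: if $T,T'$ are trees with $\mathbf{\Gamma}_T^{(1)}=\mathbf{\Gamma}_{T'}^{(1)}$, then $N_{a,b}(T)=N_{a,b}(T')$ for all positive integers $a,b$.
   Context: All graphs are finite and simple. For a tree $T$ and $S\subseteq E(T)$, let $\overline{S}$ be the set of vertices incident to some edge of $S$; define $\mathbf{\Gamma}_T^{(1)}(x,y)=\sum_{S\subseteq E(T),\,|S|=1}\prod_{v\in\overline{S}}\frac{xy^{\deg(v)}}{1+xy^{\deg(v)}}=\sum_{\{v,w\}\in E(T)}\frac{xy^{\deg v}}{1+xy^{\deg v}}\cdot\frac{xy^{\deg w}}{1+xy^{\deg w}}$. The double-degree number $N_{a,b}(T)$ is the number of edges of $T$ whose endpoints have degrees $a$ and $b$ (in $T$). -}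

module Defs where

open import Data.Bool using (Bool; true; false; if_then_else_; _∧_; _∨_)
open import Data.Nat using (ℕ; zero; suc; _≤_; _≡ᵇ_; _<ᵇ_)
open import Data.Fin using (Fin; toℕ)
open import Data.Integer using (ℤ; +_) renaming (_+_ to _+ℤ_; _*_ to _*ℤ_)
open import Data.List using (List; []; _∷_; _++_; map; concatMap; foldr; length; allFin; filterᵇ)
open import Data.Nat.ListAction using (sum)
open import Data.List.Relation.Unary.Unique.Propositional using (Unique)
open import Data.Product using (_×_; _,_)
open import Relation.Binary.PropositionalEquality using (_≡_)
open import Relation.Nullary using (¬_)

record Graph (n : ℕ) : Set where
  field
    adj    : Fin n → Fin n → Bool
    sym    : ∀ i j → adj i j ≡ adj j i
    irrefl : ∀ i → adj i i ≡ false
open Graph public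

Adjacent : ∀ {n} → Graph n → Fin n → Fin n → Set
Adjacent G i j = adj G i j ≡ true

data Reachable {n} (G : Graph n) : Fin n → Fin n → Set where
  here : ∀ {i} → Reachable G i i
  step : ∀ {i j k} → Adjacent G i j → Reachable G j k → Reachable G i k

Connected : ∀ {n} → Graph n → Set
Connected G = ∀ i j → Reachable G i j

ChainAdj : ∀ {n} → Graph n → List (Fin n) → Set
ChainAdj G []           = Data.Unit.⊤ where import Data.Unit
ChainAdj G (v ∷ [])     = Data.Unit.⊤ where import Data.Unit
ChainAdj G (v ∷ w ∷ vs) = Adjacent G v w × ChainAdj G (w ∷ vs)

IsCycle : ∀ {n} → Graph n → List (Fin n) → Set
IsCycle G []       = Data.Empty.⊥ where import Data.Empty
IsCycle G (v ∷ vs) = (3 ≤ length (v ∷ vs)) × Unique (v ∷ vs)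
                     × ChainAdj G (v ∷ vs ++ v ∷ [])

Acyclic : ∀ {n} → Graph n → Set
Acyclic G = ∀ vs → ¬ IsCycle G vs

IsTree : ∀ {n} → Graph n → Set
IsTree {n} G = (1 ≤ n) × Connected G × Acyclic G

deg : ∀ {n} → Graph n → Fin n → ℕ
deg {n} G i = sum (map (λ j → if adj G i j then 1 else 0) (allFin n))

edges : ∀ {n} → Graph n → List (Fin n × Fin n)
edges {n} G = concatMap (λ i → map (λ j → (i , j))
                 (filterᵇ (λ j → (toℕ i <ᵇ toℕ j) ∧ adj G i j) (allFin n))) (allFin n)

N : ∀ {n} → ℕ → ℕ → Graph n → ℕ
N a b G = length (filterᵇ test (edges G))
  where
  test : _ → Bool
  test (v , w) = ((deg G v ≡ᵇ a) ∧ (deg G w ≡ᵇ b)) ∨ ((deg G v ≡ᵇ b) ∧ (deg G w ≡ᵇ a))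

-- Polynomials in ℤ[x,y] as finite lists of monomials (coefficient, x-exponent, y-exponent)

Poly : Set
Poly = List (ℤ × ℕ × ℕ)

coeff : Poly → ℕ → ℕ → ℤ
coeff []               i j = + 0
coeff ((c , a , b) ∷ p) i j = (if (a ≡ᵇ i) ∧ (b ≡ᵇ j) then c else + 0) +ℤ coeff p i j

_+P_ : Poly → Poly → Poly
p +P q = p ++ q

_*P_ : Poly → Poly → Poly
p *P q = concatMap (λ { (c , a , b) → map (λ { (d , a' , b') → (c *ℤ d , a Data.Nat.+ a' , b Data.Nat.+ b') }) q }) p

_≈P_ : Poly → Poly → Set
p ≈P q = ∀ i j → coeff p i j ≡ coeff q i j

-- Rational functions in ℚ(x,y) as fractions numerator / denominator
-- (all denominators arising below are nonzero polynomials: products of 1 + x y^d)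

RatFun : Set
RatFun = Poly × Poly

_+R_ : RatFun → RatFun → RatFun
(n₁ , d₁) +R (n₂ , d₂) = ((n₁ *P d₂) +P (n₂ *P d₁)) , (d₁ *P d₂)

_*R_ : RatFun → RatFun → RatFun
(n₁ , d₁) *R (n₂ , d₂) = (n₁ *P n₂) , (d₁ *P d₂)

0R : RatFun
0R = [] , ((+ 1 , 0 , 0) ∷ [])

_≈R_ : RatFun → RatFun → Set
(n₁ , d₁) ≈R (n₂ , d₂) = (n₁ *P d₂) ≈P (n₂ *P d₁)

-- x y^d / (1 + x y^d)
frac : ℕ → RatFun
frac d = ((+ 1 , 1 , d) ∷ []) , ((+ 1 , 0 , 0) ∷ (+ 1 , 1 , d) ∷ [])

Γ1 : ∀ {n} → Graph n → RatFun
Γ1 G = foldr (λ { (v , w) acc → (frac (deg G v) *R frac (deg G w)) +R acc }) 0R (edges G)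

module Submission where

-- Expand Γ in ℤ[[x, y]], where all its denominators are invertible. The term of an edge with
-- degrees a ≥ b is x²y^(a+b) / ((1 + x yᵃ)(1 + x yᵇ)), whose coefficient of x^(2+Z) is a polynomial
-- in y of degree b + a (1 + Z) with nonzero top coefficient. When Z bounds all degrees, this
-- exponent is the base-(1 + Z) number with digits a and b, so it determines the unordered pair
-- {a, b}. Taking the pair with the largest such exponent, only edges of that type contribute to the
-- coefficient there, so both trees have equally many of them; discarding them from both sides and
-- repeating recovers every double-degree number.

open import Data.Bool using (true; false; if_then_else_; _∧_)
open import Data.Integer as ℤ using (ℤ; +_; -_; 0ℤ; ∣_∣)
  renaming (_+_ to _+ℤ_; _*_ to _*ℤ_; _-_ to _-ℤ_)
import Data.Integer.Properties as ℤ
open import Data.Integer.Tactic.RingSolver using (solve-∀)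
open import Data.List using (List; []; _∷_; _++_; map; foldr; length; filter)
open import Data.List.Extrema.Nat using (argmax; argmax-all; f[xs]≤f[argmax])
open import Data.List.Membership.Propositional using (_∈_)
open import Data.List.Properties
  using (foldr-map; foldr-cong; filter-≐; filter-accept; filter-reject; filter-++; filter-notAll)
open import Data.List.Relation.Unary.All using (All; []; _∷_)
import Data.List.Relation.Unary.All as All
import Data.List.Relation.Unary.All.Properties as All
open import Data.List.Relation.Unary.Any using (here)
import Data.List.Relation.Unary.Any as Any
open import Data.Nat
  using (ℕ; zero; suc; _+_; _*_; _∸_; _≤_; _<_; _≡ᵇ_; _≟_; _≤?_; _⊔_; _⊓_; _%_; s≤s; z≤n)
import Data.Nat.DivMod as ℕ
import Data.Nat.Properties as ℕ
open import Data.Nat.Tactic.RingSolver using () renaming (solve-∀ to ℕ-solve-∀)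
open import Data.Product using (_×_; _,_; proj₁; proj₂)
open import Data.Sum using (_⊎_; inj₁; inj₂)
open import Defs hiding (sym)
open import Function using (_∘_)
open import Relation.Binary.PropositionalEquality
  using (_≡_; _≢_; _≗_; refl; sym; trans; cong; cong₂; subst; subst₂; module ≡-Reasoning)
open import Relation.Nullary using (Dec; yes; no; ¬_; ¬?)
open import Relation.Nullary.Decidable using (does; dec-true; dec-false; _×-dec_; _⊎-dec_)

open import Algebra.Properties.AbelianGroup ℤ.+-0-abelianGroup using (∙-cancelˡ)
open ≡-Reasoning

private
  variable
    A B : Set

module _ (z : A) where

  shift : ℕ → (ℕ → A) → ℕ → A
  shift zero    f i       = f i
  shift (suc a) f zero    = z
  shift (suc a) f (suc i) = shift a f i

  shift-cong : ∀ a {f g} → f ≗ g → shift a f ≗ shift a g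
  shift-cong zero    f≗g i       = f≗g i
  shift-cong (suc a) f≗g zero    = refl
  shift-cong (suc a) f≗g (suc i) = shift-cong a f≗g i

  shift-pad : ∀ a i → shift a (λ _ → z) i ≡ z
  shift-pad zero    i       = refl
  shift-pad (suc a) zero    = refl
  shift-pad (suc a) (suc i) = shift-pad a i

  shift-+ : ∀ a a′ f i → shift (a + a′) f i ≡ shift a (shift a′ f) i
  shift-+ zero    a′ f i       = refl
  shift-+ (suc a) a′ f zero    = refl
  shift-+ (suc a) a′ f (suc i) = shift-+ a a′ f i

  shift-below : ∀ a f {i} → i < a → shift a f i ≡ z
  shift-below (suc a) f {zero}  _         = refl
  shift-below (suc a) f {suc i} (s≤s i<a) = shift-below a f i<a

  shift-above : ∀ a f {i} → a ≤ i → shift a f i ≡ f (i ∸ a)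
  shift-above zero    f         _         = refl
  shift-above (suc a) f {suc i} (s≤s a≤i) = shift-above a f a≤i

  shift-local : ∀ a {f g} i → (∀ k → a + k ≤ i → f k ≡ g k) → shift a f i ≡ shift a g i
  shift-local zero    i       agree = agree i ℕ.≤-refl
  shift-local (suc a) zero    agree = refl
  shift-local (suc a) (suc i) agree = shift-local a i (λ k a+k≤i → agree k (s≤s a+k≤i))

  shift-indicator : ∀ a k (x : A) i →
    shift a (λ i → if k ≡ᵇ i then x else z) i ≡ (if a + k ≡ᵇ i then x else z)
  shift-indicator zero    k x i       = refl
  shift-indicator (suc a) k x zero    = refl
  shift-indicator (suc a) k x (suc i) = shift-indicator a k x i

  shift-comm : ∀ a b (F : ℕ → ℕ → A) i j →
    shift b (λ j → shift a (λ i → F i j) i) j ≡ shift a (λ i → shift b (F i) j) i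
  shift-comm zero    b F i       j = refl
  shift-comm (suc a) b F zero    j = shift-pad b j
  shift-comm (suc a) b F (suc i) j = shift-comm a b F i j

shift-map : ∀ {z : A} {z′ : B} (h : A → B) → h z ≡ z′ →
  ∀ a f i → shift z′ a (h ∘ f) i ≡ h (shift z a f i)
shift-map h hz zero    f i       = refl
shift-map h hz (suc a) f zero    = sym hz
shift-map h hz (suc a) f (suc i) = shift-map h hz a f i

shift-zip : ∀ {z : A} (_∙_ : A → A → A) → z ∙ z ≡ z →
  ∀ a f g i → shift z a (λ i → f i ∙ g i) i ≡ shift z a f i ∙ shift z a g i
shift-zip _∙_ zz zero    f g i       = refl
shift-zip _∙_ zz (suc a) f g zero    = sym zz
shift-zip _∙_ zz (suc a) f g (suc i) = shift-zip _∙_ zz a f g i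

filter-filter-⊆ : ∀ {P Q : A → Set} (P? : ∀ x → Dec (P x)) (Q? : ∀ x → Dec (Q x)) →
  (∀ {x} → P x → Q x) → ∀ xs → filter P? (filter Q? xs) ≡ filter P? xs
filter-filter-⊆ P? Q? P⇒Q []       = refl
filter-filter-⊆ P? Q? P⇒Q (x ∷ xs) with Q? x
... | no ¬Qx = trans (filter-filter-⊆ P? Q? P⇒Q xs) (sym (filter-reject P? (¬Qx ∘ P⇒Q)))
... | yes _ with does (P? x)
...   | true  = cong (x ∷_) (filter-filter-⊆ P? Q? P⇒Q xs)
...   | false = filter-filter-⊆ P? Q? P⇒Q xs

length-filter-map : ∀ {P : A → Set} {Q : B → Set} (P? : ∀ x → Dec (P x)) (Q? : ∀ y → Dec (Q y)) (f : A → B) →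
  (∀ x → does (P? x) ≡ does (Q? (f x))) → ∀ xs → length (filter P? xs) ≡ length (filter Q? (map f xs))
length-filter-map P? Q? f same []       = refl
length-filter-map P? Q? f same (x ∷ xs) with does (P? x) | does (Q? (f x)) | same x
... | true  | .true  | refl = cong suc (length-filter-map P? Q? f same xs)
... | false | .false | refl = length-filter-map P? Q? f same xs

-- F i j is the coefficient of xⁱ yʲ, and shift₂ a b is multiplication by xᵃ yᵇ.
Series : Set
Series = ℕ → ℕ → ℤ

infix 4 _≗₂_
_≗₂_ : Series → Series → Set
F ≗₂ G = ∀ i j → F i j ≡ G i j

zeroₛ : Series
zeroₛ _ _ = 0ℤ

infixl 6 _+ₛ_
_+ₛ_ : Series → Series → Series
(F +ₛ G) i j = F i j +ℤ G i j

infixl 7 _·ₛ_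
_·ₛ_ : ℤ → Series → Series
(c ·ₛ F) i j = c *ℤ F i j

mono : ℤ → ℕ → ℕ → Series
mono c a b i j = if (a ≡ᵇ i) ∧ (b ≡ᵇ j) then c else 0ℤ

shift₂ : ℕ → ℕ → Series → Series
shift₂ a b F i j = shift 0ℤ a (λ i′ → shift 0ℤ b (F i′) j) i

shift₂-cong : ∀ a b {F G} → F ≗₂ G → shift₂ a b F ≗₂ shift₂ a b G
shift₂-cong a b F≗G i j = shift-cong 0ℤ a (λ i′ → shift-cong 0ℤ b (F≗G i′) j) i

shift₂-zero : ∀ a b → shift₂ a b zeroₛ ≗₂ zeroₛ
shift₂-zero a b i j = trans (shift-cong 0ℤ a (λ _ → shift-pad 0ℤ b j) i) (shift-pad 0ℤ a i)

shift₂-+ : ∀ a b F G → shift₂ a b (F +ₛ G) ≗₂ shift₂ a b F +ₛ shift₂ a b G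
shift₂-+ a b F G i j =
  trans (shift-cong 0ℤ a (λ i′ → shift-zip _+ℤ_ refl b (F i′) (G i′) j) i)
        (shift-zip _+ℤ_ refl a _ _ i)

shift₂-· : ∀ a b c F → shift₂ a b (c ·ₛ F) ≗₂ c ·ₛ shift₂ a b F
shift₂-· a b c F i j =
  trans (shift-cong 0ℤ a (λ i′ → shift-map (c *ℤ_) (ℤ.*-zeroʳ c) b (F i′) j) i)
        (shift-map (c *ℤ_) (ℤ.*-zeroʳ c) a _ i)

shift₂-shift₂ : ∀ a b a′ b′ F → shift₂ (a + a′) (b + b′) F ≗₂ shift₂ a b (shift₂ a′ b′ F)
shift₂-shift₂ a b a′ b′ F i j = begin
  shift 0ℤ (a + a′) (λ i′ → shift 0ℤ (b + b′) (F i′) j) i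
    ≡⟨ shift-+ 0ℤ a a′ _ i ⟩
  shift 0ℤ a (shift 0ℤ a′ (λ i′ → shift 0ℤ (b + b′) (F i′) j)) i
    ≡⟨ shift-cong 0ℤ a (shift-cong 0ℤ a′ (λ i′ → shift-+ 0ℤ b b′ (F i′) j)) i ⟩
  shift 0ℤ a (shift 0ℤ a′ (λ i′ → shift 0ℤ b (shift 0ℤ b′ (F i′)) j)) i
    ≡⟨ shift-cong 0ℤ a (λ i″ → sym (shift-comm 0ℤ a′ b (λ i′ → shift 0ℤ b′ (F i′)) i″ j)) i ⟩
  shift₂ a b (shift₂ a′ b′ F) i j ∎

shift₂-comm : ∀ a b a′ b′ F → shift₂ a b (shift₂ a′ b′ F) ≗₂ shift₂ a′ b′ (shift₂ a b F)
shift₂-comm a b a′ b′ F i j = begin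
  shift₂ a b (shift₂ a′ b′ F) i j   ≡⟨ shift₂-shift₂ a b a′ b′ F i j ⟨
  shift₂ (a + a′) (b + b′) F i j   ≡⟨ cong₂ (λ u v → shift₂ u v F i j) (ℕ.+-comm a a′) (ℕ.+-comm b b′) ⟩
  shift₂ (a′ + a) (b′ + b) F i j   ≡⟨ shift₂-shift₂ a′ b′ a b F i j ⟩
  shift₂ a′ b′ (shift₂ a b F) i j   ∎

shift₂-mono : ∀ a b c a′ b′ → shift₂ a b (mono c a′ b′) ≗₂ mono c (a + a′) (b + b′)
shift₂-mono a b c a′ b′ i j =
  trans (shift-cong 0ℤ a column i)
        (trans (shift-indicator 0ℤ a a′ (if b + b′ ≡ᵇ j then c else 0ℤ) i) (if-∧ (a + a′ ≡ᵇ i)))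
  where
  if-∧ : ∀ X {Y} → (if X then (if Y then c else 0ℤ) else 0ℤ) ≡ (if X ∧ Y then c else 0ℤ)
  if-∧ true  = refl
  if-∧ false = refl
  column : ∀ i′ → shift 0ℤ b (mono c a′ b′ i′) j ≡ (if a′ ≡ᵇ i′ then (if b + b′ ≡ᵇ j then c else 0ℤ) else 0ℤ)
  column i′ with a′ ≡ᵇ i′
  ... | true  = shift-indicator 0ℤ b b′ c j
  ... | false = shift-pad 0ℤ b j

Term : Set
Term = ℤ × ℕ × ℕ

_·ₜ_ : Term → Term → Term
(c , a , b) ·ₜ (d , a′ , b′) = (c *ℤ d , a + a′ , b + b′)

infixr 8 _▹_
_▹_ : Poly → Series → Series
[]                ▹ F = zeroₛ
((c , a , b) ∷ p) ▹ F = c ·ₛ shift₂ a b F +ₛ p ▹ F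

unitₛ : Series
unitₛ = mono (+ 1) 0 0

▹-cong : ∀ p {F G} → F ≗₂ G → p ▹ F ≗₂ p ▹ G
▹-cong []                F≗G i j = refl
▹-cong ((c , a , b) ∷ p) F≗G i j =
  cong₂ (λ u v → c *ℤ u +ℤ v) (shift₂-cong a b F≗G i j) (▹-cong p F≗G i j)

▹-zero : ∀ p → p ▹ zeroₛ ≗₂ zeroₛ
▹-zero []                i j = refl
▹-zero ((c , a , b) ∷ p) i j = begin
  c *ℤ shift₂ a b zeroₛ i j +ℤ (p ▹ zeroₛ) i j ≡⟨ cong₂ (λ u v → c *ℤ u +ℤ v) (shift₂-zero a b i j) (▹-zero p i j) ⟩
  c *ℤ 0ℤ +ℤ 0ℤ                               ≡⟨ cong (_+ℤ 0ℤ) (ℤ.*-zeroʳ c) ⟩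
  0ℤ                                          ∎

▹-++ : ∀ p q F → (p ++ q) ▹ F ≗₂ p ▹ F +ₛ q ▹ F
▹-++ []                q F i j = sym (ℤ.+-identityˡ _)
▹-++ ((c , a , b) ∷ p) q F i j =
  trans (cong (c *ℤ shift₂ a b F i j +ℤ_) (▹-++ p q F i j)) (sym (ℤ.+-assoc (c *ℤ shift₂ a b F i j) _ _))

▹-+ : ∀ p F G → p ▹ (F +ₛ G) ≗₂ p ▹ F +ₛ p ▹ G
▹-+ []                F G i j = refl
▹-+ ((c , a , b) ∷ p) F G i j = begin
  c *ℤ shift₂ a b (F +ₛ G) i j +ℤ (p ▹ (F +ₛ G)) i j
    ≡⟨ cong₂ _+ℤ_ (cong (c *ℤ_) (shift₂-+ a b F G i j)) (▹-+ p F G i j) ⟩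
  c *ℤ (shift₂ a b F i j +ℤ shift₂ a b G i j) +ℤ ((p ▹ F) i j +ℤ (p ▹ G) i j)
    ≡⟨ distribute c _ _ _ _ ⟩
  (c *ℤ shift₂ a b F i j +ℤ (p ▹ F) i j) +ℤ (c *ℤ shift₂ a b G i j +ℤ (p ▹ G) i j) ∎
  where
  distribute : ∀ c x y u v → c *ℤ (x +ℤ y) +ℤ (u +ℤ v) ≡ (c *ℤ x +ℤ u) +ℤ (c *ℤ y +ℤ v)
  distribute = solve-∀

▹-· : ∀ p d F → p ▹ (d ·ₛ F) ≗₂ d ·ₛ (p ▹ F)
▹-· []                d F i j = sym (ℤ.*-zeroʳ d)
▹-· ((c , a , b) ∷ p) d F i j = begin
  c *ℤ shift₂ a b (d ·ₛ F) i j +ℤ (p ▹ (d ·ₛ F)) i j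
    ≡⟨ cong₂ _+ℤ_ (cong (c *ℤ_) (shift₂-· a b d F i j)) (▹-· p d F i j) ⟩
  c *ℤ (d *ℤ shift₂ a b F i j) +ℤ d *ℤ (p ▹ F) i j
    ≡⟨ factor c d _ _ ⟩
  d *ℤ (c *ℤ shift₂ a b F i j +ℤ (p ▹ F) i j) ∎
  where
  factor : ∀ c d x u → c *ℤ (d *ℤ x) +ℤ d *ℤ u ≡ d *ℤ (c *ℤ x +ℤ u)
  factor = solve-∀

▹-shift₂ : ∀ p a b F → p ▹ shift₂ a b F ≗₂ shift₂ a b (p ▹ F)
▹-shift₂ []                  a b F i j = sym (shift₂-zero a b i j)
▹-shift₂ ((c , a′ , b′) ∷ p) a b F i j = begin
  c *ℤ shift₂ a′ b′ (shift₂ a b F) i j +ℤ (p ▹ shift₂ a b F) i j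
    ≡⟨ cong₂ (λ u v → c *ℤ u +ℤ v) (shift₂-comm a′ b′ a b F i j) (▹-shift₂ p a b F i j) ⟩
  c *ℤ shift₂ a b (shift₂ a′ b′ F) i j +ℤ shift₂ a b (p ▹ F) i j
    ≡⟨ cong (_+ℤ shift₂ a b (p ▹ F) i j) (shift₂-· a b c (shift₂ a′ b′ F) i j) ⟨
  shift₂ a b (c ·ₛ shift₂ a′ b′ F) i j +ℤ shift₂ a b (p ▹ F) i j
    ≡⟨ shift₂-+ a b _ _ i j ⟨
  shift₂ a b (((c , a′ , b′) ∷ p) ▹ F) i j ∎

▹-comm : ∀ p q F → p ▹ q ▹ F ≗₂ q ▹ p ▹ F
▹-comm p []                F i j = ▹-zero p i j
▹-comm p ((c , a , b) ∷ q) F i j = begin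
  (p ▹ (c ·ₛ shift₂ a b F +ₛ q ▹ F)) i j
    ≡⟨ ▹-+ p _ _ i j ⟩
  (p ▹ (c ·ₛ shift₂ a b F)) i j +ℤ (p ▹ q ▹ F) i j
    ≡⟨ cong₂ _+ℤ_ (▹-· p c (shift₂ a b F) i j) (▹-comm p q F i j) ⟩
  c *ℤ (p ▹ shift₂ a b F) i j +ℤ (q ▹ p ▹ F) i j
    ≡⟨ cong (λ u → c *ℤ u +ℤ (q ▹ p ▹ F) i j) (▹-shift₂ p a b F i j) ⟩
  c *ℤ shift₂ a b (p ▹ F) i j +ℤ (q ▹ p ▹ F) i j ∎

▹-map-·ₜ : ∀ c a b q F → map ((c , a , b) ·ₜ_) q ▹ F ≗₂ c ·ₛ shift₂ a b (q ▹ F)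
▹-map-·ₜ c a b [] F i j =
  sym (trans (cong (c *ℤ_) (shift₂-zero a b i j)) (ℤ.*-zeroʳ c))
▹-map-·ₜ c a b ((d , a′ , b′) ∷ q) F i j = begin
  (c *ℤ d) *ℤ shift₂ (a + a′) (b + b′) F i j +ℤ (map ((c , a , b) ·ₜ_) q ▹ F) i j
    ≡⟨ cong₂ (λ u v → (c *ℤ d) *ℤ u +ℤ v) (shift₂-shift₂ a b a′ b′ F i j) (▹-map-·ₜ c a b q F i j) ⟩
  (c *ℤ d) *ℤ shift₂ a b (shift₂ a′ b′ F) i j +ℤ c *ℤ shift₂ a b (q ▹ F) i j
    ≡⟨ factor c d _ _ ⟩
  c *ℤ (d *ℤ shift₂ a b (shift₂ a′ b′ F) i j +ℤ shift₂ a b (q ▹ F) i j)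
    ≡⟨ cong (λ u → c *ℤ (u +ℤ shift₂ a b (q ▹ F) i j)) (shift₂-· a b d _ i j) ⟨
  c *ℤ (shift₂ a b (d ·ₛ shift₂ a′ b′ F) i j +ℤ shift₂ a b (q ▹ F) i j)
    ≡⟨ cong (c *ℤ_) (shift₂-+ a b _ _ i j) ⟨
  c *ℤ shift₂ a b (((d , a′ , b′) ∷ q) ▹ F) i j ∎
  where
  factor : ∀ c d x y → (c *ℤ d) *ℤ x +ℤ c *ℤ y ≡ c *ℤ (d *ℤ x +ℤ y)
  factor = solve-∀

▹-* : ∀ p q F → (p *P q) ▹ F ≗₂ p ▹ q ▹ F
▹-* []                q F i j = refl
▹-* ((c , a , b) ∷ p) q F i j =
  trans (▹-++ (map ((c , a , b) ·ₜ_) q) (p *P q) F i j)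
        (cong₂ _+ℤ_ (▹-map-·ₜ c a b q F i j) (▹-* p q F i j))

▹-unit : ∀ q → q ▹ unitₛ ≗₂ coeff q
▹-unit []                i j = refl
▹-unit ((c , a , b) ∷ q) i j = cong₂ _+ℤ_ (begin
  c *ℤ shift₂ a b (mono (+ 1) 0 0) i j   ≡⟨ cong (c *ℤ_) (shift₂-mono a b (+ 1) 0 0 i j) ⟩
  c *ℤ mono (+ 1) (a + 0) (b + 0) i j   ≡⟨ cong₂ (λ u v → c *ℤ mono (+ 1) u v i j) (ℕ.+-identityʳ a) (ℕ.+-identityʳ b) ⟩
  c *ℤ mono (+ 1) a b i j               ≡⟨ scale ((a ≡ᵇ i) ∧ (b ≡ᵇ j)) ⟩
  mono c a b i j                        ∎) (▹-unit q i j)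
  where
  scale : ∀ X → c *ℤ (if X then + 1 else 0ℤ) ≡ (if X then c else 0ℤ)
  scale true  = ℤ.*-identityʳ c
  scale false = ℤ.*-zeroʳ c

coeff-* : ∀ p q → coeff (p *P q) ≗₂ p ▹ coeff q
coeff-* p q i j = begin
  coeff (p *P q) i j        ≡⟨ ▹-unit (p *P q) i j ⟨
  ((p *P q) ▹ unitₛ) i j    ≡⟨ ▹-* p q unitₛ i j ⟩
  (p ▹ q ▹ unitₛ) i j       ≡⟨ ▹-cong p (▹-unit q) i j ⟩
  (p ▹ coeff q) i j         ∎

▹-coeff-comm : ∀ p q → p ▹ coeff q ≗₂ q ▹ coeff p
▹-coeff-comm p q i j = begin
  (p ▹ coeff q) i j         ≡⟨ ▹-cong p (λ i j → sym (▹-unit q i j)) i j ⟩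
  (p ▹ q ▹ unitₛ) i j       ≡⟨ ▹-comm p q unitₛ i j ⟩
  (q ▹ p ▹ unitₛ) i j       ≡⟨ ▹-cong q (▹-unit p) i j ⟩
  (q ▹ coeff p) i j         ∎

shift₂-local : ∀ a b F F′ i j → 1 ≤ a + b →
  (∀ i′ j′ → i′ + j′ < i + j → F i′ j′ ≡ F′ i′ j′) → shift₂ a b F i j ≡ shift₂ a b F′ i j
shift₂-local a b F F′ i j 1≤a+b agree =
  shift-local 0ℤ a i (λ k a+k≤i → shift-local 0ℤ b j (λ l b+l≤j → agree k l (smaller k l a+k≤i b+l≤j)))
  where
  smaller : ∀ k l → a + k ≤ i → b + l ≤ j → k + l < i + j
  smaller k l a+k≤i b+l≤j = ℕ.≤-trans (ℕ.+-monoˡ-≤ (k + l) 1≤a+b)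
    (subst (_≤ i + j) (regroup a b k l) (ℕ.+-mono-≤ a+k≤i b+l≤j))
    where
    regroup : ∀ a b k l → (a + k) + (b + l) ≡ (a + b) + (k + l)
    regroup = ℕ-solve-∀

-- Only the constant term sees F at (i , j); every other term sees F at smaller total degree.
term-split : ∀ c a b F F′ i j → (∀ i′ j′ → i′ + j′ < i + j → F i′ j′ ≡ F′ i′ j′) →
  c *ℤ shift₂ a b F i j ≡ c *ℤ shift₂ a b F′ i j +ℤ mono c a b 0 0 *ℤ (F i j -ℤ F′ i j)
term-split c zero    zero    F F′ i j agree = expand c (F i j) (F′ i j)
  where
  expand : ∀ c x y → c *ℤ x ≡ c *ℤ y +ℤ c *ℤ (x -ℤ y)
  expand = solve-∀
term-split c (suc a) b       F F′ i j agree =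
  trans (cong (c *ℤ_) (shift₂-local (suc a) b F F′ i j (s≤s z≤n) agree)) (sym (ℤ.+-identityʳ _))
term-split c zero    (suc b) F F′ i j agree =
  trans (cong (c *ℤ_) (shift₂-local zero (suc b) F F′ i j (s≤s z≤n) agree)) (sym (ℤ.+-identityʳ _))

▹-split : ∀ U F F′ i j → (∀ i′ j′ → i′ + j′ < i + j → F i′ j′ ≡ F′ i′ j′) →
  (U ▹ F) i j ≡ (U ▹ F′) i j +ℤ coeff U 0 0 *ℤ (F i j -ℤ F′ i j)
▹-split []                F F′ i j agree = refl
▹-split ((c , a , b) ∷ U) F F′ i j agree =
  trans (cong₂ _+ℤ_ (term-split c a b F F′ i j agree) (▹-split U F F′ i j agree))
        (regroup (c *ℤ shift₂ a b F′ i j) (mono c a b 0 0) ((U ▹ F′) i j) (coeff U 0 0) (F i j -ℤ F′ i j))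
  where
  regroup : ∀ s m r k d → (s +ℤ m *ℤ d) +ℤ (r +ℤ k *ℤ d) ≡ (s +ℤ r) +ℤ (m +ℤ k) *ℤ d
  regroup = solve-∀

-- A series with constant term 1 is invertible in ℤ[[x, y]].
▹-injective : ∀ U → coeff U 0 0 ≡ + 1 → ∀ {F F′} → U ▹ F ≗₂ U ▹ F′ → F ≗₂ F′
▹-injective U U₀₀≡1 {F} {F′} UF≗UF′ i j = agree-below (suc (i + j)) i j ℕ.≤-refl
  where
  agree-below : ∀ n i j → i + j < n → F i j ≡ F′ i j
  agree-below (suc n) i j (s≤s i+j≤n) with ℕ.m≤n⇒m<n∨m≡n i+j≤n
  ... | inj₁ i+j<n = agree-below n i j i+j<n
  ... | inj₂ refl  = ℤ.i-j≡0⇒i≡j (F i j) (F′ i j)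
    (trans (sym (ℤ.*-identityˡ _)) (∙-cancelˡ ((U ▹ F′) i j) _ _ (begin
      (U ▹ F′) i j +ℤ + 1 *ℤ (F i j -ℤ F′ i j)            ≡⟨ cong (λ u → (U ▹ F′) i j +ℤ u *ℤ (F i j -ℤ F′ i j)) U₀₀≡1 ⟨
      (U ▹ F′) i j +ℤ coeff U 0 0 *ℤ (F i j -ℤ F′ i j)    ≡⟨ ▹-split U F F′ i j (agree-below n) ⟨
      (U ▹ F) i j                                         ≡⟨ UF≗UF′ i j ⟩
      (U ▹ F′) i j                                        ≡⟨ ℤ.+-identityʳ _ ⟨
      (U ▹ F′) i j +ℤ 0ℤ                                  ∎)))

coeff₀₀-* : ∀ p q → coeff (p *P q) 0 0 ≡ coeff p 0 0 *ℤ coeff q 0 0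
coeff₀₀-* p q = begin
  coeff (p *P q) 0 0                                         ≡⟨ coeff-* p q 0 0 ⟩
  (p ▹ coeff q) 0 0                                          ≡⟨ ▹-split p (coeff q) zeroₛ 0 0 (λ _ _ ()) ⟩
  (p ▹ zeroₛ) 0 0 +ℤ coeff p 0 0 *ℤ (coeff q 0 0 -ℤ 0ℤ)      ≡⟨ cong (_+ℤ coeff p 0 0 *ℤ (coeff q 0 0 -ℤ 0ℤ)) (▹-zero p 0 0) ⟩
  0ℤ +ℤ coeff p 0 0 *ℤ (coeff q 0 0 -ℤ 0ℤ)                   ≡⟨ simplify (coeff p 0 0) (coeff q 0 0) ⟩
  coeff p 0 0 *ℤ coeff q 0 0                                 ∎
  where
  simplify : ∀ x y → 0ℤ +ℤ x *ℤ (y -ℤ 0ℤ) ≡ x *ℤ y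
  simplify = solve-∀

coeff-++ : ∀ p q → coeff (p ++ q) ≗₂ coeff p +ₛ coeff q
coeff-++ p q i j = begin
  coeff (p ++ q) i j                    ≡⟨ ▹-unit (p ++ q) i j ⟨
  ((p ++ q) ▹ unitₛ) i j                ≡⟨ ▹-++ p q unitₛ i j ⟩
  (p ▹ unitₛ) i j +ℤ (q ▹ unitₛ) i j    ≡⟨ cong₂ _+ℤ_ (▹-unit p i j) (▹-unit q i j) ⟩
  coeff p i j +ℤ coeff q i j            ∎

coeff-*-comm : ∀ p q → coeff (p *P q) ≗₂ coeff (q *P p)
coeff-*-comm p q i j = begin
  coeff (p *P q) i j    ≡⟨ coeff-* p q i j ⟩
  (p ▹ coeff q) i j     ≡⟨ ▹-coeff-comm p q i j ⟩
  (q ▹ coeff p) i j     ≡⟨ coeff-* q p i j ⟨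
  coeff (q *P p) i j    ∎

*R-comm : ∀ R S → (R *R S) ≈R (S *R R)
*R-comm (n₁ , d₁) (n₂ , d₂) i j = begin
  coeff ((n₁ *P n₂) *P (d₂ *P d₁)) i j    ≡⟨ coeff-* (n₁ *P n₂) _ i j ⟩
  ((n₁ *P n₂) ▹ coeff (d₂ *P d₁)) i j     ≡⟨ ▹-* n₁ n₂ _ i j ⟩
  (n₁ ▹ n₂ ▹ coeff (d₂ *P d₁)) i j        ≡⟨ ▹-comm n₁ n₂ _ i j ⟩
  (n₂ ▹ n₁ ▹ coeff (d₂ *P d₁)) i j        ≡⟨ ▹-cong n₂ (▹-cong n₁ (coeff-*-comm d₂ d₁)) i j ⟩
  (n₂ ▹ n₁ ▹ coeff (d₁ *P d₂)) i j        ≡⟨ ▹-* n₂ n₁ _ i j ⟨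
  ((n₂ *P n₁) ▹ coeff (d₁ *P d₂)) i j     ≡⟨ coeff-* (n₂ *P n₁) _ i j ⟨
  coeff ((n₂ *P n₁) *P (d₁ *P d₂)) i j    ∎

record IsExpansion (R : RatFun) (F : Series) : Set where
  field
    constant-term : coeff (proj₂ R) 0 0 ≡ + 1
    den▹expansion : proj₂ R ▹ F ≗₂ coeff (proj₁ R)
open IsExpansion

expansion-cross : ∀ {P Q F} → IsExpansion (P , Q) F → ∀ V → V ▹ Q ▹ F ≗₂ coeff (P *P V)
expansion-cross {P} {Q} {F} e V i j = begin
  (V ▹ Q ▹ F) i j      ≡⟨ ▹-cong V (den▹expansion e) i j ⟩
  (V ▹ coeff P) i j    ≡⟨ ▹-coeff-comm V P i j ⟩
  (P ▹ coeff V) i j    ≡⟨ coeff-* P V i j ⟨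
  coeff (P *P V) i j   ∎

expansion-0R : IsExpansion 0R zeroₛ
expansion-0R = record { constant-term = refl ; den▹expansion = ▹-zero (proj₂ 0R) }

expansion-+R : ∀ {P₁ Q₁ P₂ Q₂ F G} → IsExpansion (P₁ , Q₁) F → IsExpansion (P₂ , Q₂) G →
  IsExpansion ((P₁ , Q₁) +R (P₂ , Q₂)) (F +ₛ G)
expansion-+R {P₁} {Q₁} {P₂} {Q₂} {F} {G} e₁ e₂ = record
  { constant-term = trans (coeff₀₀-* Q₁ Q₂) (cong₂ _*ℤ_ (constant-term e₁) (constant-term e₂))
  ; den▹expansion = λ i j → begin
      ((Q₁ *P Q₂) ▹ (F +ₛ G)) i j                        ≡⟨ ▹-* Q₁ Q₂ _ i j ⟩
      (Q₁ ▹ Q₂ ▹ (F +ₛ G)) i j                           ≡⟨ ▹-cong Q₁ (▹-+ Q₂ F G) i j ⟩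
      (Q₁ ▹ (Q₂ ▹ F +ₛ Q₂ ▹ G)) i j                      ≡⟨ ▹-+ Q₁ _ _ i j ⟩
      (Q₁ ▹ Q₂ ▹ F) i j +ℤ (Q₁ ▹ Q₂ ▹ G) i j             ≡⟨ cong (_+ℤ (Q₁ ▹ Q₂ ▹ G) i j) (▹-comm Q₁ Q₂ F i j) ⟩
      (Q₂ ▹ Q₁ ▹ F) i j +ℤ (Q₁ ▹ Q₂ ▹ G) i j             ≡⟨ cong₂ _+ℤ_ (expansion-cross e₁ Q₂ i j) (expansion-cross e₂ Q₁ i j) ⟩
      coeff (P₁ *P Q₂) i j +ℤ coeff (P₂ *P Q₁) i j       ≡⟨ coeff-++ (P₁ *P Q₂) (P₂ *P Q₁) i j ⟨
      coeff ((P₁ *P Q₂) +P (P₂ *P Q₁)) i j               ∎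
  }

expansion-unique : ∀ {R S F G} → IsExpansion R F → IsExpansion S G → R ≈R S → F ≗₂ G
expansion-unique {P , Q} {P′ , Q′} {F} {G} e e′ R≈S =
  ▹-injective (Q′ *P Q) (trans (coeff₀₀-* Q′ Q) (cong₂ _*ℤ_ (constant-term e′) (constant-term e))) λ i j → begin
    ((Q′ *P Q) ▹ F) i j    ≡⟨ ▹-* Q′ Q F i j ⟩
    (Q′ ▹ Q ▹ F) i j       ≡⟨ expansion-cross e Q′ i j ⟩
    coeff (P *P Q′) i j    ≡⟨ R≈S i j ⟩
    coeff (P′ *P Q) i j    ≡⟨ expansion-cross e′ Q i j ⟨
    (Q ▹ Q′ ▹ G) i j       ≡⟨ ▹-comm Q Q′ G i j ⟩
    (Q′ ▹ Q ▹ G) i j       ≡⟨ ▹-* Q′ Q G i j ⟨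
    ((Q′ *P Q) ▹ G) i j    ∎

1+xy^ : ℕ → Poly
1+xy^ d = (+ 1 , 0 , 0) ∷ (+ 1 , 1 , d) ∷ []

x²y^ : ℕ → Poly
x²y^ d = (+ 1 , 2 , d) ∷ []

sgn : ℕ → ℤ
sgn zero    = + 1
sgn (suc i) = - sgn i

δ : ℕ → ℕ → ℕ
δ k j = if k ≡ᵇ j then 1 else 0

ψ : ℕ → Series
ψ a i j = sgn i *ℤ + δ (i * a) j

-- C a b i j counts the k ≤ i with k a + (i ∸ k) b = j, so that h a b = 1 / ((1 + x yᵃ)(1 + x yᵇ)).
C : ℕ → ℕ → ℕ → ℕ → ℕ
C a b zero    = δ 0
C a b (suc i) j = δ (suc i * a) j + shift 0 b (C a b i) j

h : ℕ → ℕ → Series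
h a b i j = sgn i *ℤ + C a b i j

g : ℕ → ℕ → Series
g a b = x²y^ (a + b) ▹ h a b

1+xy^▹ψ : ∀ a → 1+xy^ a ▹ ψ a ≗₂ unitₛ
1+xy^▹ψ a zero    j = trans (drop-zeros (+ δ 0 j)) (+δ (0 ≡ᵇ j))
  where
  +δ : ∀ X → + (if X then 1 else 0) ≡ (if X then + 1 else 0ℤ)
  +δ true  = refl
  +δ false = refl
  drop-zeros : ∀ x → + 1 *ℤ (+ 1 *ℤ x) +ℤ (+ 1 *ℤ 0ℤ +ℤ 0ℤ) ≡ x
  drop-zeros = solve-∀
1+xy^▹ψ a (suc i) j = begin
  + 1 *ℤ ψ a (suc i) j +ℤ (+ 1 *ℤ shift 0ℤ a (ψ a i) j +ℤ 0ℤ)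
    ≡⟨ cong (λ u → + 1 *ℤ ψ a (suc i) j +ℤ (+ 1 *ℤ u +ℤ 0ℤ)) previous-row ⟩
  + 1 *ℤ (- sgn i *ℤ + δ (suc i * a) j) +ℤ (+ 1 *ℤ (sgn i *ℤ + δ (suc i * a) j) +ℤ 0ℤ)
    ≡⟨ cancel (sgn i) (+ δ (suc i * a) j) ⟩
  0ℤ ∎
  where
  previous-row : shift 0ℤ a (ψ a i) j ≡ sgn i *ℤ + δ (suc i * a) j
  previous-row = begin
    shift 0ℤ a (λ j → sgn i *ℤ + δ (i * a) j) j    ≡⟨ shift-map (λ n → sgn i *ℤ + n) (ℤ.*-zeroʳ (sgn i)) a (δ (i * a)) j ⟩
    sgn i *ℤ + shift 0 a (δ (i * a)) j             ≡⟨ cong (λ n → sgn i *ℤ + n) (shift-indicator 0 a (i * a) 1 j) ⟩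
    sgn i *ℤ + δ (suc i * a) j                     ∎
  cancel : ∀ s x → + 1 *ℤ (- s *ℤ x) +ℤ (+ 1 *ℤ (s *ℤ x) +ℤ 0ℤ) ≡ 0ℤ
  cancel = solve-∀

1+xy^▹h : ∀ a b → 1+xy^ b ▹ h a b ≗₂ ψ a
1+xy^▹h a b zero    j = drop-zeros (+ δ 0 j)
  where
  drop-zeros : ∀ x → + 1 *ℤ (+ 1 *ℤ x) +ℤ (+ 1 *ℤ 0ℤ +ℤ 0ℤ) ≡ + 1 *ℤ x
  drop-zeros = solve-∀
1+xy^▹h a b (suc i) j = begin
  + 1 *ℤ (- sgn i *ℤ + (δ (suc i * a) j + S)) +ℤ (+ 1 *ℤ shift 0ℤ b (h a b i) j +ℤ 0ℤ)
    ≡⟨ cong₂ (λ u v → + 1 *ℤ (- sgn i *ℤ u) +ℤ (+ 1 *ℤ v +ℤ 0ℤ)) (ℤ.pos-+ (δ (suc i * a) j) S) previous-row ⟩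
  + 1 *ℤ (- sgn i *ℤ (+ δ (suc i * a) j +ℤ + S)) +ℤ (+ 1 *ℤ (sgn i *ℤ + S) +ℤ 0ℤ)
    ≡⟨ cancel (sgn i) (+ δ (suc i * a) j) (+ S) ⟩
  - sgn i *ℤ + δ (suc i * a) j ∎
  where
  S = shift 0 b (C a b i) j
  previous-row : shift 0ℤ b (h a b i) j ≡ sgn i *ℤ + S
  previous-row = shift-map (λ n → sgn i *ℤ + n) (ℤ.*-zeroʳ (sgn i)) b (C a b i) j
  cancel : ∀ s x y → + 1 *ℤ (- s *ℤ (x +ℤ y)) +ℤ (+ 1 *ℤ (s *ℤ y) +ℤ 0ℤ) ≡ - s *ℤ x
  cancel = solve-∀

expansion-frac² : ∀ a b → IsExpansion (frac a *R frac b) (g a b)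
expansion-frac² a b = record
  { constant-term = coeff₀₀-* (1+xy^ a) (1+xy^ b)
  ; den▹expansion = λ i j → begin
      ((1+xy^ a *P 1+xy^ b) ▹ m ▹ h a b) i j    ≡⟨ ▹-* (1+xy^ a) (1+xy^ b) (m ▹ h a b) i j ⟩
      (1+xy^ a ▹ 1+xy^ b ▹ m ▹ h a b) i j       ≡⟨ ▹-cong (1+xy^ a) (▹-comm (1+xy^ b) m (h a b)) i j ⟩
      (1+xy^ a ▹ m ▹ 1+xy^ b ▹ h a b) i j       ≡⟨ ▹-cong (1+xy^ a) (▹-cong m (1+xy^▹h a b)) i j ⟩
      (1+xy^ a ▹ m ▹ ψ a) i j                   ≡⟨ ▹-comm (1+xy^ a) m (ψ a) i j ⟩
      (m ▹ 1+xy^ a ▹ ψ a) i j                   ≡⟨ ▹-cong m (1+xy^▹ψ a) i j ⟩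
      (m ▹ unitₛ) i j                           ≡⟨ ▹-unit m i j ⟩
      coeff m i j                               ∎
  }
  where
  m = x²y^ (a + b)

g-sym : ∀ a b → g a b ≗₂ g b a
g-sym a b = expansion-unique (expansion-frac² a b) (expansion-frac² b a) (*R-comm (frac a) (frac b))

δ-refl : ∀ k → δ k k ≡ 1
δ-refl k = cong (λ X → if X then 1 else 0) (dec-true (k ≟ k) refl)

δ-≢ : ∀ {k j} → k ≢ j → δ k j ≡ 0
δ-≢ {k} {j} k≢j = cong (λ X → if X then 1 else 0) (dec-false (k ≟ j) k≢j)

C-vanish : ∀ {a b} i {j} → b ≤ a → i * a < j → C a b i j ≡ 0
C-vanish {a} {b} zero    {suc j} _   _       = refl
C-vanish {a} {b} (suc i) {j}     b≤a i*a<j = cong₂ _+_ (δ-≢ (ℕ.<⇒≢ i*a<j)) previous-row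
  where
  previous-row : shift 0 b (C a b i) j ≡ 0
  previous-row with b ≤? j
  ... | no  b≰j = shift-below 0 b (C a b i) (ℕ.≰⇒> b≰j)
  ... | yes b≤j = trans (shift-above 0 b (C a b i) b≤j) (C-vanish i b≤a (ℕ.m+n≤o⇒m≤o∸n (suc (i * a)) below))
    where
    below : suc (i * a) + b ≤ j
    below = ℕ.≤-trans (s≤s (ℕ.+-monoʳ-≤ (i * a) b≤a)) (subst (λ n → suc n ≤ j) (ℕ.+-comm a (i * a)) i*a<j)

C-diagonal-pos : ∀ a b i → 1 ≤ C a b i (i * a)
C-diagonal-pos a b zero    = s≤s z≤n
C-diagonal-pos a b (suc i) = subst (λ n → 1 ≤ n + shift 0 b (C a b i) (suc i * a)) (sym (δ-refl (suc i * a))) (s≤s z≤n)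

∣sgn∣ : ∀ i → ∣ sgn i ∣ ≡ 1
∣sgn∣ zero    = refl
∣sgn∣ (suc i) = trans (ℤ.∣-i∣≡∣i∣ (sgn i)) (∣sgn∣ i)

g-row : ∀ a b i j → g a b (2 + i) j ≡ shift 0ℤ (a + b) (h a b i) j
g-row a b i j = drop-unit (shift 0ℤ (a + b) (h a b i) j)
  where
  drop-unit : ∀ x → + 1 *ℤ x +ℤ 0ℤ ≡ x
  drop-unit = solve-∀

top-exponent : ∀ a b i → b + a * suc i ≡ i * a + (a + b)
top-exponent = ℕ-solve-∀

g-row-vanish : ∀ {a b} i {j} → b ≤ a → b + a * suc i < j → g a b (2 + i) j ≡ 0ℤ
g-row-vanish {a} {b} i {j} b≤a top<j = begin
  g a b (2 + i) j
    ≡⟨ g-row a b i j ⟩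
  shift 0ℤ (a + b) (h a b i) j
    ≡⟨ shift-above 0ℤ (a + b) (h a b i) (ℕ.≤-trans (ℕ.m≤n+m (a + b) (i * a)) (ℕ.<⇒≤ below)) ⟩
  sgn i *ℤ + C a b i (j ∸ (a + b))
    ≡⟨ cong (λ n → sgn i *ℤ + n) (C-vanish i b≤a (ℕ.m+n≤o⇒m≤o∸n (suc (i * a)) below)) ⟩
  sgn i *ℤ 0ℤ
    ≡⟨ ℤ.*-zeroʳ (sgn i) ⟩
  0ℤ ∎
  where
  below : i * a + (a + b) < j
  below = subst (_< j) (top-exponent a b i) top<j

sgn·-nonzero : ∀ i {c} → 1 ≤ c → sgn i *ℤ + c ≢ 0ℤ
sgn·-nonzero i {c} 1≤c sgn·c≡0 = ℕ.<⇒≢ 1≤c (sym (begin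
  c                        ≡⟨ ℕ.*-identityˡ c ⟨
  1 * c                    ≡⟨ cong (_* c) (∣sgn∣ i) ⟨
  ∣ sgn i ∣ * c             ≡⟨ ℤ.abs-* (sgn i) (+ c) ⟨
  ∣ sgn i *ℤ + c ∣          ≡⟨ cong ∣_∣ sgn·c≡0 ⟩
  0                        ∎))

g-row-top : ∀ a b i → g a b (2 + i) (b + a * suc i) ≢ 0ℤ
g-row-top a b i = sgn·-nonzero i (C-diagonal-pos a b i) ∘ trans (sym (begin
  g a b (2 + i) (b + a * suc i)                     ≡⟨ g-row a b i _ ⟩
  shift 0ℤ (a + b) (h a b i) (b + a * suc i)        ≡⟨ cong (shift 0ℤ (a + b) (h a b i)) (top-exponent a b i) ⟩
  shift 0ℤ (a + b) (h a b i) (i * a + (a + b))      ≡⟨ shift-above 0ℤ (a + b) (h a b i) (ℕ.m≤n+m (a + b) (i * a)) ⟩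
  h a b i (i * a + (a + b) ∸ (a + b))               ≡⟨ cong (h a b i) (ℕ.m+n∸n≡m (i * a) (a + b)) ⟩
  h a b i (i * a)                                   ∎))

infix 4 _∼_ _∼?_
_∼_ : ℕ × ℕ → ℕ × ℕ → Set
(x , y) ∼ (a , b) = (x ≡ a × y ≡ b) ⊎ (x ≡ b × y ≡ a)

_∼?_ : ∀ p q → Dec (p ∼ q)
(x , y) ∼? (a , b) = (x ≟ a ×-dec y ≟ b) ⊎-dec (x ≟ b ×-dec y ≟ a)

∼-refl : ∀ {p} → p ∼ p
∼-refl = inj₁ (refl , refl)

∼-sym : ∀ {p q} → p ∼ q → q ∼ p
∼-sym (inj₁ (refl , refl)) = inj₁ (refl , refl)
∼-sym (inj₂ (refl , refl)) = inj₂ (refl , refl)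

∼-trans : ∀ {p q r} → p ∼ q → q ∼ r → p ∼ r
∼-trans (inj₁ (refl , refl)) q∼r                  = q∼r
∼-trans (inj₂ (refl , refl)) (inj₁ (refl , refl)) = inj₂ (refl , refl)
∼-trans (inj₂ (refl , refl)) (inj₂ (refl , refl)) = inj₁ (refl , refl)

∼-sorted : ∀ x y → (x , y) ∼ (x ⊔ y , x ⊓ y)
∼-sorted x y with ℕ.≤-total x y
... | inj₁ x≤y = inj₂ (sym (ℕ.m≤n⇒m⊓n≡m x≤y) , sym (ℕ.m≤n⇒m⊔n≡n x≤y))
... | inj₂ y≤x = inj₁ (sym (ℕ.m≥n⇒m⊔n≡m y≤x) , sym (ℕ.m≥n⇒m⊓n≡n y≤x))

Bounded : ℕ → ℕ × ℕ → Set
Bounded Z (x , y) = x ≤ Z × y ≤ Z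

key : ℕ → ℕ × ℕ → ℕ
key Z (x , y) = x ⊓ y + (x ⊔ y) * suc Z

base-digits : ∀ Z {l l′ h h′} → l ≤ Z → l′ ≤ Z → l + h * suc Z ≡ l′ + h′ * suc Z → l ≡ l′ × h ≡ h′
base-digits Z {l} {l′} {h} {h′} l≤Z l′≤Z eq = l≡l′ , h≡h′
  where
  l≡l′ : l ≡ l′
  l≡l′ = begin
    l                       ≡⟨ ℕ.m≤n⇒m%n≡m l≤Z ⟨
    l % suc Z               ≡⟨ ℕ.[m+kn]%n≡m%n l h (suc Z) ⟨
    (l + h * suc Z) % suc Z   ≡⟨ cong (_% suc Z) eq ⟩
    (l′ + h′ * suc Z) % suc Z ≡⟨ ℕ.[m+kn]%n≡m%n l′ h′ (suc Z) ⟩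
    l′ % suc Z              ≡⟨ ℕ.m≤n⇒m%n≡m l′≤Z ⟩
    l′                      ∎
  h≡h′ : h ≡ h′
  h≡h′ = ℕ.*-cancelʳ-≡ h h′ (suc Z) (ℕ.+-cancelˡ-≡ l _ _ (trans eq (cong (_+ h′ * suc Z) (sym l≡l′))))

key-injective : ∀ Z {p q} → Bounded Z p → Bounded Z q → key Z p ≡ key Z q → p ∼ q
key-injective Z {x , y} {a , b} (x≤Z , _) (a≤Z , _) eq
  with base-digits Z (ℕ.≤-trans (ℕ.m⊓n≤m x y) x≤Z) (ℕ.≤-trans (ℕ.m⊓n≤m a b) a≤Z) eq
... | lo≡lo , hi≡hi = ∼-trans (∼-sorted x y)
  (subst₂ (λ u v → (u , v) ∼ (a , b)) (sym hi≡hi) (sym lo≡lo) (∼-sym (∼-sorted a b)))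

gₚ : ℕ × ℕ → Series
gₚ (a , b) = g a b

gₚ-resp : ∀ {p q} → p ∼ q → gₚ p ≗₂ gₚ q
gₚ-resp {x , y} (inj₁ (refl , refl)) i j = refl
gₚ-resp {x , y} (inj₂ (refl , refl)) = g-sym x y

gₚ-vanish : ∀ Z p {j} → key Z p < j → gₚ p (2 + Z) j ≡ 0ℤ
gₚ-vanish Z (x , y) key<j =
  trans (gₚ-resp (∼-sorted x y) (2 + Z) _) (g-row-vanish Z (ℕ.m⊓n≤m⊔n x y) key<j)

gₚ-top : ∀ Z p → gₚ p (2 + Z) (key Z p) ≢ 0ℤ
gₚ-top Z (x , y) g≡0 =
  g-row-top (x ⊔ y) (x ⊓ y) Z (trans (sym (gₚ-resp (∼-sorted x y) (2 + Z) _)) g≡0)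

count : ℕ × ℕ → List (ℕ × ℕ) → ℕ
count q ps = length (filter (_∼? q) ps)

dropClass : ℕ × ℕ → List (ℕ × ℕ) → List (ℕ × ℕ)
dropClass q = filter (¬? ∘ (_∼? q))

Σg : List (ℕ × ℕ) → Series
Σg []       = zeroₛ
Σg (p ∷ ps) = gₚ p +ₛ Σg ps

count-resp : ∀ {p q} → p ∼ q → ∀ ps → count p ps ≡ count q ps
count-resp p∼q ps =
  cong length (filter-≐ (_∼? _) (_∼? _) ((λ x∼p → ∼-trans x∼p p∼q) , (λ x∼q → ∼-trans x∼q (∼-sym p∼q))) ps)

count-dropClass : ∀ {p q} → ¬ p ∼ q → ∀ ps → count p (dropClass q ps) ≡ count p ps
count-dropClass p≁q ps =
  cong length (filter-filter-⊆ (_∼? _) (¬? ∘ (_∼? _)) (λ x∼p x∼q → p≁q (∼-trans (∼-sym x∼p) x∼q)) ps)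

Σg-split : ∀ q ps → Σg ps ≗₂ + count q ps ·ₛ gₚ q +ₛ Σg (dropClass q ps)
Σg-split q []       i j = refl
Σg-split q (x ∷ xs) i j with x ∼? q
... | yes x∼q
  rewrite filter-accept (_∼? q) {xs = xs} x∼q | filter-reject (¬? ∘ (_∼? q)) {xs = xs} (λ x≁q → x≁q x∼q) = begin
  gₚ x i j +ℤ Σg xs i j
    ≡⟨ cong₂ _+ℤ_ (gₚ-resp x∼q i j) (Σg-split q xs i j) ⟩
  gₚ q i j +ℤ (+ count q xs *ℤ gₚ q i j +ℤ Σg (dropClass q xs) i j)
    ≡⟨ collect (gₚ q i j) (+ count q xs) _ ⟩
  (+ 1 +ℤ + count q xs) *ℤ gₚ q i j +ℤ Σg (dropClass q xs) i j
    ≡⟨ cong (λ n → n *ℤ gₚ q i j +ℤ Σg (dropClass q xs) i j) (ℤ.pos-+ 1 (count q xs)) ⟨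
  + suc (count q xs) *ℤ gₚ q i j +ℤ Σg (dropClass q xs) i j ∎
  where
  collect : ∀ v n r → v +ℤ (n *ℤ v +ℤ r) ≡ (+ 1 +ℤ n) *ℤ v +ℤ r
  collect = solve-∀
... | no x≁q
  rewrite filter-reject (_∼? q) {xs = xs} x≁q | filter-accept (¬? ∘ (_∼? q)) {xs = xs} x≁q =
  trans (cong (gₚ x i j +ℤ_) (Σg-split q xs i j)) (swap (gₚ x i j) (+ count q xs *ℤ gₚ q i j) (Σg (dropClass q xs) i j))
  where
  swap : ∀ v c r → v +ℤ (c +ℤ r) ≡ c +ℤ (v +ℤ r)
  swap = solve-∀

Σg-vanish : ∀ Z {j} ps → All (λ p → key Z p < j) ps → Σg ps (2 + Z) j ≡ 0ℤ
Σg-vanish Z []       []                 = refl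
Σg-vanish Z (p ∷ ps) (key<j ∷ keys<j) = cong₂ _+ℤ_ (gₚ-vanish Z p key<j) (Σg-vanish Z ps keys<j)

Σg-dropClass : ∀ q {ps ps′} → count q ps ≡ count q ps′ → Σg ps ≗₂ Σg ps′ →
  Σg (dropClass q ps) ≗₂ Σg (dropClass q ps′)
Σg-dropClass q {ps} {ps′} same Σ≗ i j = ∙-cancelˡ (+ count q ps *ℤ gₚ q i j) _ _ (begin
  + count q ps *ℤ gₚ q i j +ℤ Σg (dropClass q ps) i j     ≡⟨ Σg-split q ps i j ⟨
  Σg ps i j                                                ≡⟨ Σ≗ i j ⟩
  Σg ps′ i j                                               ≡⟨ Σg-split q ps′ i j ⟩
  + count q ps′ *ℤ gₚ q i j +ℤ Σg (dropClass q ps′) i j   ≡⟨ cong (λ n → + n *ℤ gₚ q i j +ℤ Σg (dropClass q ps′) i j) same ⟨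
  + count q ps *ℤ gₚ q i j +ℤ Σg (dropClass q ps′) i j    ∎)

count-cancel : ∀ {n m v} → v ≢ 0ℤ → + n *ℤ v ≡ + m *ℤ v → n ≡ m
count-cancel {n} {m} {v} v≢0 eq = ℤ.+-injective (ℤ.*-cancelʳ-≡ (+ n) (+ m) v ⦃ ℤ.≢-nonZero v≢0 ⦄ eq)

-- At x^(2+Z) y^(key Z t) only pairs ∼ t contribute, as the x^(2+Z)-row of gₚ p vanishes beyond key Z p.
count-top : ∀ Z t {ps ps′} → Bounded Z t → All (Bounded Z) (ps ++ ps′) →
  All (λ p → key Z p ≤ key Z t) (ps ++ ps′) → Σg ps ≗₂ Σg ps′ → count t ps ≡ count t ps′
count-top Z t {ps} {ps′} t-bounded bounded below Σ≗ = count-cancel (gₚ-top Z t) (begin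
  + count t ps *ℤ gₚ t I J     ≡⟨ Σg-at-top ps (All.++⁻ˡ ps bounded) (All.++⁻ˡ ps below) ⟨
  Σg ps I J                    ≡⟨ Σ≗ I J ⟩
  Σg ps′ I J                   ≡⟨ Σg-at-top ps′ (All.++⁻ʳ ps bounded) (All.++⁻ʳ ps below) ⟩
  + count t ps′ *ℤ gₚ t I J    ∎)
  where
  I = 2 + Z
  J = key Z t
  Σg-at-top : ∀ qs → All (Bounded Z) qs → All (λ p → key Z p ≤ J) qs → Σg qs I J ≡ + count t qs *ℤ gₚ t I J
  Σg-at-top qs qs-bounded qs-below = begin
    Σg qs I J
      ≡⟨ Σg-split t qs I J ⟩
    + count t qs *ℤ gₚ t I J +ℤ Σg (dropClass t qs) I J
      ≡⟨ cong (+ count t qs *ℤ gₚ t I J +ℤ_) (Σg-vanish Z (dropClass t qs) strictly-below) ⟩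
    + count t qs *ℤ gₚ t I J +ℤ 0ℤ
      ≡⟨ ℤ.+-identityʳ _ ⟩
    + count t qs *ℤ gₚ t I J ∎
    where
    drop? = ¬? ∘ (_∼? t)
    strictly-below : All (λ p → key Z p < J) (dropClass t qs)
    strictly-below = All.zipWith
      (λ ((p-bounded , p-below) , p≁t) → ℕ.≤∧≢⇒< p-below (p≁t ∘ key-injective Z p-bounded t-bounded))
      (All.zip (All.filter⁺ drop? qs-bounded , All.filter⁺ drop? qs-below) , All.all-filter drop? qs)

counts-from-class : ∀ t {ps ps′} → count t ps ≡ count t ps′ →
  (∀ q → count q (dropClass t ps) ≡ count q (dropClass t ps′)) → ∀ q → count q ps ≡ count q ps′
counts-from-class t {ps} {ps′} same rest q with q ∼? t
... | yes q∼t = trans (count-resp q∼t ps) (trans same (sym (count-resp q∼t ps′)))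
... | no  q≁t = trans (sym (count-dropClass q≁t ps)) (trans (rest q) (count-dropClass q≁t ps′))

CountsAgree : ℕ → ℕ → Set
CountsAgree Z n = ∀ ps ps′ → length (ps ++ ps′) ≤ n → All (Bounded Z) (ps ++ ps′) →
  Σg ps ≗₂ Σg ps′ → ∀ q → count q ps ≡ count q ps′

peel-top-class : ∀ Z n → CountsAgree Z n → ∀ ps ps′ {p} → p ∈ ps ++ ps′ → length (ps ++ ps′) ≤ suc n →
  All (Bounded Z) (ps ++ ps′) → Σg ps ≗₂ Σg ps′ → ∀ q → count q ps ≡ count q ps′
peel-top-class Z n agree ps ps′ {p} p∈ length≤ bounded Σ≗ =
  counts-from-class t {ps} {ps′} same
    (agree (dropClass t ps) (dropClass t ps′) shorter bounded′ (Σg-dropClass t {ps} {ps′} same Σ≗))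
  where
  L = ps ++ ps′
  t = argmax (key Z) p L
  drop? = ¬? ∘ (_∼? t)
  t∈L : t ∈ L
  t∈L = argmax-all (key Z) {P = _∈ L} p∈ (All.tabulate (λ x∈ → x∈))
  t-bounded : Bounded Z t
  t-bounded = All.lookup bounded t∈L
  same : count t ps ≡ count t ps′
  same = count-top Z t {ps} {ps′} t-bounded bounded (f[xs]≤f[argmax] p L) Σ≗
  dropClass-++ : dropClass t L ≡ dropClass t ps ++ dropClass t ps′
  dropClass-++ = filter-++ drop? ps ps′
  shorter : length (dropClass t ps ++ dropClass t ps′) ≤ n
  shorter = subst (λ xs → length xs ≤ n) dropClass-++
    (ℕ.≤-pred (ℕ.≤-trans (filter-notAll drop? L (Any.map (λ { refl ¬t∼t → ¬t∼t ∼-refl }) t∈L)) length≤))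
  bounded′ : All (Bounded Z) (dropClass t ps ++ dropClass t ps′)
  bounded′ = subst (All (Bounded Z)) dropClass-++ (All.filter⁺ drop? bounded)

counts-agree : ∀ Z n → CountsAgree Z n
counts-agree Z n       []       []       _ _ _ q = refl
counts-agree Z (suc n) (p ∷ ps) ps′      length≤ = peel-top-class Z n (counts-agree Z n) (p ∷ ps) ps′ (here refl) length≤
counts-agree Z (suc n) []       (p ∷ ps′) length≤ = peel-top-class Z n (counts-agree Z n) [] (p ∷ ps′) (here refl) length≤

weight : List (ℕ × ℕ) → ℕ
weight []             = 0
weight ((x , y) ∷ ps) = x + y + weight ps

Bounded-mono : ∀ {Z Z′} p → Z ≤ Z′ → Bounded Z p → Bounded Z′ p
Bounded-mono (x , y) Z≤Z′ (x≤Z , y≤Z) = ℕ.≤-trans x≤Z Z≤Z′ , ℕ.≤-trans y≤Z Z≤Z′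

all-bounded : ∀ ps → All (Bounded (weight ps)) ps
all-bounded []             = []
all-bounded ((x , y) ∷ ps) =
  (ℕ.≤-trans (ℕ.m≤m+n x y) x+y≤ , ℕ.≤-trans (ℕ.m≤n+m y x) x+y≤)
  ∷ All.map (λ {p} → Bounded-mono p (ℕ.m≤n+m (weight ps) (x + y))) (all-bounded ps)
  where
  x+y≤ : x + y ≤ x + y + weight ps
  x+y≤ = ℕ.m≤m+n (x + y) (weight ps)

ΓL : List (ℕ × ℕ) → RatFun
ΓL = foldr (λ p acc → (frac (proj₁ p) *R frac (proj₂ p)) +R acc) 0R

expansion-ΓL : ∀ ps → IsExpansion (ΓL ps) (Σg ps)
expansion-ΓL []             = expansion-0R
expansion-ΓL ((a , b) ∷ ps) = expansion-+R (expansion-frac² a b) (expansion-ΓL ps)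

counts-determined : ∀ ps ps′ → ΓL ps ≈R ΓL ps′ → ∀ q → count q ps ≡ count q ps′
counts-determined ps ps′ Γ≈ =
  counts-agree (weight (ps ++ ps′)) (length (ps ++ ps′)) ps ps′ ℕ.≤-refl (all-bounded (ps ++ ps′))
    (expansion-unique (expansion-ΓL ps) (expansion-ΓL ps′) Γ≈)

degreePairs : ∀ {n} → Graph n → List (ℕ × ℕ)
degreePairs T = map (λ e → deg T (proj₁ e) , deg T (proj₂ e)) (edges T)

Γ1≡ΓL : ∀ {n} (T : Graph n) → Γ1 T ≡ ΓL (degreePairs T)
Γ1≡ΓL T = sym (trans (foldr-map _ _ 0R (edges T)) (foldr-cong (λ _ _ → refl) refl (edges T)))

-- The edge test in the definition of N is, by computation, the decision procedure of _∼?_.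
N≡count : ∀ {n} (T : Graph n) a b → N a b T ≡ count (a , b) (degreePairs T)
N≡count T a b = length-filter-map _ (_∼? (a , b)) _ (λ _ → refl) (edges T)

theorem4p4 : ∀ {n m} (T : Graph n) (T′ : Graph m) → IsTree T → IsTree T′ → Γ1 T ≈R Γ1 T′ → ∀ (a b : ℕ) → 1 ≤ a → 1 ≤ b → N a b T ≡ N a b T′
theorem4p4 T T′ _ _ Γ≈ a b _ _ = begin
  N a b T                           ≡⟨ N≡count T a b ⟩
  count (a , b) (degreePairs T)     ≡⟨ counts-determined (degreePairs T) (degreePairs T′)
                                         (subst₂ _≈R_ (Γ1≡ΓL T) (Γ1≡ΓL T′) Γ≈) (a , b) ⟩
  count (a , b) (degreePairs T′)    ≡⟨ N≡count T′ a b ⟨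
  N a b T′                          ∎
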